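{- Let $D_n^+=\{\pi\in D_n:\pi(n)>0\}$. Then for $n\ge 1$, \[\sum_{\pi\in D_n^+}t^{\operatorname{des}_D(\pi)}=\sum_{k=0}^{n-1}\binom{n}{k}D_k(t)(t-1)^{n-k-1},\] where $D_k(t)=\sum_{\pi\in D_k}t^{\operatorname{des}_D(\pi)}$, with $D_0(t)=D_1(t)=1$.
   Context: $D_n$ is the group of even signed permutations: bijections $\pi$ of $[-n,n]$ with $\pi(-i)=-\pi(i)$ and an even number of negative entries among $\pi(1),\dots,\pi(n)$, written $[\pi(1),\dots,\pi(n)]$. $\operatorname{Des}(\pi)=\{i\in[n-1]:\pi(i)\ge\pi(i+1)\}$; $\operatorname{Des}_D(\pi)=\operatorname{Des}(\pi)\cup\{0\}$ if $\pi(1)+\pi(2)<0$ and $\operatorname{Des}(\pi)$ if $\pi(1)+\pi(2)>0$ (for $n\le1$ the unique element has no descents); $\operatorname{des}_D(\pi)=|\operatorname{Des}_D(\pi)|$. -}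

module Defs where

open import Data.Bool using (Bool; true; false; _∧_; if_then_else_; not)
open import Data.Nat as ℕ using (ℕ; zero; suc)
open import Data.Nat.Combinatorics using (_C_)
open import Data.Integer as ℤ using (ℤ; +_; -_; _≤ᵇ_)
open import Data.List using (List; []; _∷_; map; filter; concatMap; length; upTo; foldr; last)
open import Data.Bool.ListAction using (all; any)
open import Relation.Nullary.Decidable.Core using (T?)
open import Data.Maybe using (Maybe; just; nothing)

oneTo : ℕ → List ℕ
oneTo n = map suc (upTo n)

signedVals : ℕ → List ℤ
signedVals n = map (λ i → + i) (oneTo n) Data.List.++ map (λ i → - (+ i)) (oneTo n)

words : ℕ → List ℤ → List (List ℤ)
words zero    A = [] ∷ []
words (suc k) A = concatMap (λ a → map (a ∷_) (words k A)) A

isNeg : ℤ → Bool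
isNeg x = not (+ 0 ≤ᵇ x)

isPos : ℤ → Bool
isPos x = + 1 ≤ᵇ x

countNeg : List ℤ → ℕ
countNeg = foldr (λ x c → if isNeg x then suc c else c) 0

even : ℕ → Bool
even zero = true
even (suc n) = not (even n)

-- a word [π(1),…,π(n)] of length n with entries in ±[n] is a signed permutation
-- iff every j ∈ [n] occurs as some |π(i)|
isSignedPerm : ℕ → List ℤ → Bool
isSignedPerm n π = all (λ j → any (λ x → ℤ.∣ x ∣ ℕ.≡ᵇ j) π) (oneTo n)

isDn : ℕ → List ℤ → Bool
isDn n π = isSignedPerm n π ∧ even (countNeg π)

-- the group D_n, listed (each element exactly once) as [π(1),…,π(n)]
Dn : ℕ → List (List ℤ)
Dn n = filter (λ π → T? (isDn n π)) (words n (signedVals n))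

lastPos : List ℤ → Bool
lastPos π with last π
... | just x  = isPos x
... | nothing = false

Dn⁺ : ℕ → List (List ℤ)
Dn⁺ n = filter (λ π → T? (lastPos π)) (Dn n)

des : List ℤ → ℕ
des []           = 0
des (x ∷ [])     = 0
des (x ∷ y ∷ xs) = (if y ≤ᵇ x then 1 else 0) ℕ.+ des (y ∷ xs)

desD : List ℤ → ℕ
desD (x ∷ y ∷ xs) = (if isNeg (x ℤ.+ y) then 1 else 0) ℕ.+ des (x ∷ y ∷ xs)
desD π            = des π

desDPoly : List (List ℤ) → ℤ → ℤ
desDPoly S t = foldr (λ π acc → (t ℤ.^ desD π) ℤ.+ acc) (+ 0) S

Dpoly : ℕ → ℤ → ℤ
Dpoly k t = desDPoly (Dn k) t

sumBelow : ℕ → (ℕ → ℤ) → ℤ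
sumBelow n f = foldr (λ k acc → f k ℤ.+ acc) (+ 0) (upTo n)

-- For π = σ ++ τ with |σ| = k, call [τ positive and decreasing] · t^{des_D σ} · (t-1)^{n-k-1} the k-th
-- term of π. For a word with distinct neighbours these terms sum to [π(n) > 0] · t^{des_D π}: by induction
-- on π, the terms for the splits before and after π(1) combine to t^{[π(1) > π(2)]} times the first term
-- of π(2)…π(n), since (t - 1) + 1 = t. The extra type-D descent at position 0 is harmless, because a
-- positive decreasing tail after a start with π(1) + π(2) < 0 would leave an odd number of negative
-- entries. Summing over D_n and exchanging the sums, the positive decreasing tails of length n - k are
-- the C(n,k) subsets of [n] of that size, and for each the prefixes are exactly the signed permutations
-- of the complementary k values with an even number of negatives. Relabelling those values
-- order-preservingly by 1, …, k identifies the prefixes with D_k and preserves des_D, so each tail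
-- contributes D_k(t) (t-1)^{n-k-1}.

module Submission where

open import Defs
open import Data.Nat using (ℕ; _≥_; _∸_; _≡ᵇ_)
open import Data.Nat.Combinatorics using (_C_)
open import Data.Integer using (ℤ; +_; _+_; _*_; _-_; _^_)
open import Relation.Binary.PropositionalEquality using (_≡_)

open import Data.Bool using (Bool; true; false; if_then_else_; _∧_; not; T)
open import Data.Bool.Properties using (∧-identityʳ; ∧-zeroʳ; ∧-comm; ∧-assoc; T-≡; T-∧)
open import Data.Bool.ListAction using (all; any)
open import Data.Empty using (⊥-elim)
open import Data.Nat as ℕ using (zero; suc; z≤n; s≤s)
import Data.Nat.Properties as ℕ
open import Data.Nat.Combinatorics using (nCk+nC[k+1]≡[n+1]C[k+1]; nCk≡nC[n∸k])
open import Data.Integer as ℤ using (-[1+_]; ∣_∣; _⊖_; _≤ᵇ_; _≤_; _<_; +≤+; -≤-; -≤+)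
import Data.Integer.Properties as ℤ
open import Data.Integer.Tactic.RingSolver using (solve-∀)
open import Data.List using (List; []; _∷_; map; filter; concatMap; foldr; length; upTo; take; drop; _++_)
open import Data.List.Properties
  using (map-upTo; upTo-∷ʳ; map-∘; map-cong-local; map-++; filter-all; filter-++; length-map; length-upTo; length-++)
open import Data.List.Relation.Unary.All as All using (All; []; _∷_)
import Data.List.Relation.Unary.All.Properties as All
open import Data.List.Relation.Unary.Any as Any using (here; there)
open import Data.List.Relation.Unary.Any.Properties using (any⁺; any⁻)
import Data.List.Relation.Unary.Any.Properties as Any
open import Data.List.Relation.Unary.AllPairs using (AllPairs; []; _∷_)
import Data.List.Relation.Unary.AllPairs as AllPairs
import Data.List.Relation.Unary.AllPairs.Properties as AllPairs
open import Data.List.Relation.Unary.Linked using (Linked; []; [-]; _∷_)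
open import Data.List.Relation.Unary.Linked.Properties using (AllPairs⇒Linked)
open import Data.List.Relation.Unary.Unique.Propositional using (Unique)
import Data.List.Relation.Unary.Unique.Propositional.Properties as Unique
open import Data.List.Relation.Binary.Subset.Propositional using (_⊆_)
import Data.List.Relation.Binary.Subset.Propositional.Properties as Subset
open import Data.List.Membership.Propositional using (_∈_; _∉_)
open import Data.List.Membership.Propositional.Properties
  using (∈-map⁺; ∈-map⁻; ∈-upTo⁺; ∈-upTo⁻; ∈-filter⁺; ∈-filter⁻; ∈-++⁺ˡ; ∈-++⁺ʳ; ∈-++⁻)
open import Data.Product using (_×_; _,_; proj₂)
open import Data.Sum using (inj₁; inj₂)
open import Function using (_∘_; id)
open import Function.Bundles using (Equivalence)
open import Relation.Binary.Definitions using (DecidableEquality)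
open import Relation.Binary.PropositionalEquality
  using (refl; sym; trans; cong; cong₂; subst; _≢_; ≢-sym; module ≡-Reasoning)
open import Relation.Nullary using (¬_; ¬?; yes; no; contradiction)
open import Relation.Nullary.Decidable.Core using (T?; proof)
open import Relation.Nullary.Reflects using (Reflects; ofʸ; ofⁿ; fromEquivalence; ¬-reflects; _×-reflects_; T-reflects)

reflects-≡ : ∀ {P Q : Set} {b c} → (P → Q) → (Q → P) → Reflects P b → Reflects Q c → b ≡ c
reflects-≡ P⇒Q Q⇒P (ofʸ p)  (ofʸ q)  = refl
reflects-≡ P⇒Q Q⇒P (ofʸ p)  (ofⁿ ¬q) = ⊥-elim (¬q (P⇒Q p))
reflects-≡ P⇒Q Q⇒P (ofⁿ ¬p) (ofʸ q)  = ⊥-elim (¬p (Q⇒P q))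
reflects-≡ P⇒Q Q⇒P (ofⁿ ¬p) (ofⁿ ¬q) = refl

T⇒reflected : ∀ {P : Set} {b} → Reflects P b → T b → P
T⇒reflected (ofʸ p) _ = p

reflected⇒T : ∀ {P : Set} {b} → Reflects P b → P → T b
reflected⇒T (ofʸ _)  _ = _
reflected⇒T (ofⁿ ¬p) p = ¬p p

ℕ≤ᵇ-reflects : ∀ m n → Reflects (m ℕ.≤ n) (m ℕ.≤ᵇ n)
ℕ≤ᵇ-reflects m n = proof (m ℕ.≤? n)

ℕ<ᵇ-reflects : ∀ m n → Reflects (m ℕ.< n) (m ℕ.<ᵇ n)
ℕ<ᵇ-reflects m n = proof (m ℕ.<? n)

≤ᵇ-reflects : ∀ x y → Reflects (x ≤ y) (x ≤ᵇ y)
≤ᵇ-reflects x y = fromEquivalence ℤ.≤ᵇ⇒≤ ℤ.≤⇒≤ᵇ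

≤ᵇ-flip : ∀ {x y} → x ≢ y → (y ≤ᵇ x) ≡ not (x ≤ᵇ y)
≤ᵇ-flip {x} {y} x≢y with x ≤ᵇ y | ≤ᵇ-reflects x y | y ≤ᵇ x | ≤ᵇ-reflects y x
... | true  | ofʸ x≤y | true  | ofʸ y≤x = ⊥-elim (x≢y (ℤ.≤-antisym x≤y y≤x))
... | true  | _       | false | _       = refl
... | false | _       | true  | _       = refl
... | false | ofⁿ x≰y | false | ofⁿ y≰x = ⊥-elim (x≰y (ℤ.<⇒≤ (ℤ.≰⇒> y≰x)))

isNeg-reflects : ∀ x → Reflects (x < + 0) (isNeg x)
isNeg-reflects x with + 0 ≤ᵇ x | ≤ᵇ-reflects (+ 0) x
... | true  | ofʸ 0≤x = ofⁿ (ℤ.≤⇒≯ 0≤x)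
... | false | ofⁿ 0≰x = ofʸ (ℤ.≰⇒> 0≰x)

isNeg-⊖ : ∀ m n → isNeg (m ⊖ n) ≡ (m ℕ.<ᵇ n)
isNeg-⊖ m n with m ℕ.<ᵇ n | ℕ<ᵇ-reflects m n
... | false | _       = refl
... | true  | ofʸ m<n with n ∸ m | ℕ.m<n⇒0<n∸m m<n
...   | suc _ | _ = refl

-- Finite sums

when : Bool → ℤ → ℤ
when b z = if b then z else + 0

when-T : ∀ {b} z → T b → when b z ≡ z
when-T {true} z _ = refl

when-¬ : ∀ {b} z → ¬ T b → when b z ≡ + 0
when-¬ {false} z _  = refl
when-¬ {true}  z ¬b = ⊥-elim (¬b _)

≡when : ∀ b {x y} → (T b → x ≡ y) → (¬ T b → x ≡ + 0) → x ≡ when b y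
≡when true  if-true _        = if-true _
≡when false _       if-false = if-false (λ ())

when-cong : ∀ b {x y} → (T b → x ≡ y) → when b x ≡ when b y
when-cong true  x≡y = x≡y _
when-cong false x≡y = refl

when-zero : ∀ b → when b (+ 0) ≡ + 0
when-zero true  = refl
when-zero false = refl

when-∧ : ∀ a b z → when (a ∧ b) z ≡ when a (when b z)
when-∧ true  b z = refl
when-∧ false b z = refl

when-*ˡ : ∀ b c z → when b (c * z) ≡ c * when b z
when-*ˡ true  c z = refl
when-*ˡ false c z = sym (ℤ.*-zeroʳ c)

when-*ʳ : ∀ b z c → when b (z * c) ≡ when b z * c
when-*ʳ true  z c = refl
when-*ʳ false z c = sym (ℤ.*-zeroˡ c)

∑ : ∀ {A : Set} → List A → (A → ℤ) → ℤ
∑ xs f = foldr (λ x acc → f x + acc) (+ 0) xs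

infix 5 ∑
syntax ∑ xs (λ x → e) = ∑[ x ∈ xs ] e

module _ {A : Set} where

  ∑-++ : ∀ (xs ys : List A) f → ∑ (xs ++ ys) f ≡ ∑ xs f + ∑ ys f
  ∑-++ []       ys f = sym (ℤ.+-identityˡ _)
  ∑-++ (x ∷ xs) ys f = trans (cong (_+_ (f x)) (∑-++ xs ys f)) (sym (ℤ.+-assoc (f x) _ _))

  ∑-cong : ∀ (xs : List A) {f g} → (∀ x → f x ≡ g x) → ∑ xs f ≡ ∑ xs g
  ∑-cong []       f≡g = refl
  ∑-cong (x ∷ xs) f≡g = cong₂ _+_ (f≡g x) (∑-cong xs f≡g)

  ∑-cong-All : ∀ {P : A → Set} {xs} {f g : A → ℤ} → All P xs → (∀ {x} → P x → f x ≡ g x) →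
               ∑ xs f ≡ ∑ xs g
  ∑-cong-All []         f≡g = refl
  ∑-cong-All (px ∷ pxs) f≡g = cong₂ _+_ (f≡g px) (∑-cong-All pxs f≡g)

  ∑-zero : ∀ (xs : List A) → ∑[ x ∈ xs ] + 0 ≡ + 0
  ∑-zero []       = refl
  ∑-zero (x ∷ xs) = trans (ℤ.+-identityˡ _) (∑-zero xs)

  ∑-distrib-+ : ∀ (xs : List A) f g → ∑[ x ∈ xs ] (f x + g x) ≡ ∑ xs f + ∑ xs g
  ∑-distrib-+ []       f g = refl
  ∑-distrib-+ (x ∷ xs) f g = trans (cong (_+_ (f x + g x)) (∑-distrib-+ xs f g)) (shuffle (f x) (g x) _ _)
    where
    shuffle : ∀ a b c d → a + b + (c + d) ≡ a + c + (b + d)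
    shuffle = solve-∀

  ∑-*ˡ : ∀ (xs : List A) c f → ∑[ x ∈ xs ] (c * f x) ≡ c * ∑ xs f
  ∑-*ˡ []       c f = sym (ℤ.*-zeroʳ c)
  ∑-*ˡ (x ∷ xs) c f = trans (cong (_+_ (c * f x)) (∑-*ˡ xs c f)) (sym (ℤ.*-distribˡ-+ c (f x) _))

  ∑-*ʳ : ∀ (xs : List A) f c → ∑[ x ∈ xs ] (f x * c) ≡ ∑ xs f * c
  ∑-*ʳ xs f c = trans (∑-cong xs (λ x → ℤ.*-comm (f x) c)) (trans (∑-*ˡ xs c f) (ℤ.*-comm c _))

  ∑-when : ∀ b (xs : List A) f → ∑[ x ∈ xs ] when b (f x) ≡ when b (∑ xs f)
  ∑-when true  xs f = refl
  ∑-when false xs f = ∑-zero xs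

  ∑-when-const : ∀ (xs : List A) (p : A → Bool) c →
                 ∑[ x ∈ xs ] when (p x) c ≡ c * (∑[ x ∈ xs ] when (p x) (+ 1))
  ∑-when-const xs p c =
    trans (∑-cong xs (λ x → trans (cong (when (p x)) (sym (ℤ.*-identityʳ c))) (when-*ˡ (p x) c (+ 1))))
          (∑-*ˡ xs c (λ x → when (p x) (+ 1)))

  ∑-filter : ∀ (p : A → Bool) xs f → ∑ (filter (T? ∘ p) xs) f ≡ ∑[ x ∈ xs ] when (p x) (f x)
  ∑-filter p []       f = refl
  ∑-filter p (x ∷ xs) f with p x
  ... | true  = cong (_+_ (f x)) (∑-filter p xs f)
  ... | false = trans (∑-filter p xs f) (sym (ℤ.+-identityˡ _))

module _ {A B : Set} where

  ∑-map : ∀ (g : A → B) xs f → ∑ (map g xs) f ≡ ∑ xs (f ∘ g)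
  ∑-map g []       f = refl
  ∑-map g (x ∷ xs) f = cong (_+_ (f (g x))) (∑-map g xs f)

  ∑-concatMap : ∀ (g : A → List B) xs f → ∑ (concatMap g xs) f ≡ ∑[ x ∈ xs ] ∑ (g x) f
  ∑-concatMap g []       f = refl
  ∑-concatMap g (x ∷ xs) f = trans (∑-++ (g x) _ f) (cong (_+_ (∑ (g x) f)) (∑-concatMap g xs f))

  ∑-comm : ∀ (xs : List A) (ys : List B) (f : A → B → ℤ) →
           ∑[ x ∈ xs ] ∑[ y ∈ ys ] f x y ≡ ∑[ y ∈ ys ] ∑[ x ∈ xs ] f x y
  ∑-comm []       ys f = sym (∑-zero ys)
  ∑-comm (x ∷ xs) ys f = trans (cong (_+_ (∑ ys (f x))) (∑-comm xs ys f))
                               (sym (∑-distrib-+ ys (f x) (λ y → ∑[ x ∈ xs ] f x y)))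

∑< : ℕ → (ℕ → ℤ) → ℤ
∑< n f = ∑ (upTo n) f

infix 5 ∑<
syntax ∑< n (λ k → e) = ∑[ k < n ] e

∑<-suc : ∀ n f → ∑< (suc n) f ≡ f 0 + ∑< n (f ∘ suc)
∑<-suc n f = cong (_+_ (f 0)) (trans (cong (λ xs → ∑ xs f) (sym (map-upTo suc n))) (∑-map suc (upTo n) f))

∑<-snoc : ∀ n f → ∑< (suc n) f ≡ ∑< n f + f n
∑<-snoc n f = trans (cong (λ xs → ∑ xs f) (sym (upTo-∷ʳ n)))
                    (trans (∑-++ (upTo n) (n ∷ []) f) (cong (_+_ (∑< n f)) (ℤ.+-identityʳ (f n))))

∑<-cong : ∀ n {f g} → (∀ {k} → k ℕ.< n → f k ≡ g k) → ∑< n f ≡ ∑< n g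
∑<-cong n = ∑-cong-All (All.tabulate ∈-upTo⁻)

∑-words-suc : ∀ k (A : List ℤ) f → ∑ (words (suc k) A) f ≡ ∑[ a ∈ A ] ∑[ w ∈ words k A ] f (a ∷ w)
∑-words-suc k A f = trans (∑-concatMap _ A f) (∑-cong A (λ a → ∑-map (a ∷_) (words k A) f))

∑-words-++ : ∀ k m (A : List ℤ) f →
  ∑ (words (k ℕ.+ m) A) f ≡ ∑[ σ ∈ words k A ] ∑[ τ ∈ words m A ] f (σ ++ τ)
∑-words-++ zero    m A f = sym (ℤ.+-identityʳ _)
∑-words-++ (suc k) m A f = begin
  ∑ (words (suc k ℕ.+ m) A) f
    ≡⟨ ∑-words-suc (k ℕ.+ m) A f ⟩
  ∑[ a ∈ A ] ∑[ w ∈ words (k ℕ.+ m) A ] f (a ∷ w)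
    ≡⟨ ∑-cong A (λ a → ∑-words-++ k m A (f ∘ (a ∷_))) ⟩
  ∑[ a ∈ A ] ∑[ σ ∈ words k A ] ∑[ τ ∈ words m A ] f (a ∷ σ ++ τ)
    ≡⟨ ∑-words-suc k A (λ σ → ∑[ τ ∈ words m A ] f (σ ++ τ)) ⟨
  ∑[ σ ∈ words (suc k) A ] ∑[ τ ∈ words m A ] f (σ ++ τ)
    ∎
  where open ≡-Reasoning

∑-words-map : ∀ k (g : ℤ → ℤ) A f → ∑ (words k (map g A)) f ≡ ∑ (words k A) (f ∘ map g)
∑-words-map zero    g A f = refl
∑-words-map (suc k) g A f = begin
  ∑ (words (suc k) (map g A)) f
    ≡⟨ ∑-words-suc k (map g A) f ⟩
  ∑[ b ∈ map g A ] ∑[ w ∈ words k (map g A) ] f (b ∷ w)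
    ≡⟨ ∑-map g A (λ b → ∑[ w ∈ words k (map g A) ] f (b ∷ w)) ⟩
  ∑[ a ∈ A ] ∑[ w ∈ words k (map g A) ] f (g a ∷ w)
    ≡⟨ ∑-cong A (λ a → ∑-words-map k g A (f ∘ (g a ∷_))) ⟩
  ∑[ a ∈ A ] ∑[ w ∈ words k A ] f (g a ∷ map g w)
    ≡⟨ ∑-words-suc k A (f ∘ map g) ⟨
  ∑ (words (suc k) A) (f ∘ map g)
    ∎
  where open ≡-Reasoning

∑-words-cong : ∀ k {P : ℤ → Set} {A} {f g : List ℤ → ℤ} → All P A →
  (∀ {w} → length w ≡ k → All P w → f w ≡ g w) → ∑ (words k A) f ≡ ∑ (words k A) g
∑-words-cong zero    PA f≡g = cong (_+ + 0) (f≡g refl [])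
∑-words-cong (suc k) {A = A} {f} {g} PA f≡g =
  trans (∑-words-suc k A f)
  (trans (∑-cong-All PA (λ pa → ∑-words-cong k PA (λ |w| Pw → f≡g (cong suc |w|) (pa ∷ Pw))))
  (sym (∑-words-suc k A g)))

∑-words-restrict : ∀ k (p : ℤ → Bool) A f →
  ∑[ w ∈ words k A ] when (all p w) (f w) ≡ ∑ (words k (filter (T? ∘ p) A)) f
∑-words-restrict zero    p A f = refl
∑-words-restrict (suc k) p A f =
  trans (∑-words-suc k A (λ w → when (all p w) (f w)))
  (trans (∑-cong A restrictTail)
  (trans (sym (∑-filter p A (λ a → ∑[ w ∈ words k (filter (T? ∘ p) A) ] f (a ∷ w))))
  (sym (∑-words-suc k (filter (T? ∘ p) A) f))))
  where
  restrictTail : ∀ a → ∑[ w ∈ words k A ] when (all p (a ∷ w)) (f (a ∷ w))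
                     ≡ when (p a) (∑[ w ∈ words k (filter (T? ∘ p) A) ] f (a ∷ w))
  restrictTail a with p a
  ... | true  = ∑-words-restrict k p A (f ∘ (a ∷_))
  ... | false = ∑-zero (words k A)

-- Telescoping the weight of a signed permutation

bit : Bool → ℕ
bit b = if b then 1 else 0

isPosDecreasing : List ℤ → Bool
isPosDecreasing []          = true
isPosDecreasing (x ∷ [])    = isPos x
isPosDecreasing (x ∷ y ∷ r) = not (x ≤ᵇ y) ∧ isPosDecreasing (y ∷ r)

isPosDecreasing-tail : ∀ x r → T (isPosDecreasing (x ∷ r)) → T (isPosDecreasing r)
isPosDecreasing-tail x []      _  = _
isPosDecreasing-tail x (y ∷ r) pd with x ≤ᵇ y
... | false = pd

isPosDecreasing-head : ∀ x r → T (isPosDecreasing (x ∷ r)) → + 0 < x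
isPosDecreasing-head x []      pd = ℤ.<-≤-trans (ℤ.+<+ (s≤s z≤n)) (ℤ.≤ᵇ⇒≤ pd)
isPosDecreasing-head x (y ∷ r) pd with x ≤ᵇ y | ≤ᵇ-reflects x y
... | false | ofⁿ x≰y = ℤ.<-trans (isPosDecreasing-head y r pd) (ℤ.≰⇒> x≰y)

isPosDecreasing-countNeg : ∀ τ → T (isPosDecreasing τ) → countNeg τ ≡ 0
isPosDecreasing-countNeg []      _  = refl
isPosDecreasing-countNeg (x ∷ r) pd with isNeg x | isNeg-reflects x
... | false | _       = isPosDecreasing-countNeg r (isPosDecreasing-tail x r pd)
... | true  | ofʸ x<0 = ⊥-elim (ℤ.<-asym x<0 (isPosDecreasing-head x r pd))

negativeSum-¬isPosDecreasing : ∀ x y ρ → x + y < + 0 → ¬ T (isPosDecreasing (x ∷ y ∷ ρ))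
negativeSum-¬isPosDecreasing x y ρ x+y<0 pd = ℤ.<-asym x+y<0 (ℤ.+-mono-< 0<x 0<y)
  where
  0<x = isPosDecreasing-head x (y ∷ ρ) pd
  0<y = isPosDecreasing-head y ρ (isPosDecreasing-tail x (y ∷ ρ) pd)

negativeSum-¬even : ∀ x y ρ → x + y < + 0 → T (isPosDecreasing (y ∷ ρ)) →
                    ¬ T (even (countNeg (x ∷ y ∷ ρ)))
negativeSum-¬even x y ρ x+y<0 pd with isNeg x | isNeg-reflects x
... | true  | _       rewrite isPosDecreasing-countNeg (y ∷ ρ) pd = λ ()
... | false | ofⁿ x≮0 = ⊥-elim (x≮0 (ℤ.≰⇒> (λ 0≤x → ℤ.<⇒≱ x+y<0 (ℤ.+-mono-≤ 0≤x 0≤y))))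
  where 0≤y = ℤ.<⇒≤ (isPosDecreasing-head y ρ pd)

module _ (t : ℤ) where

  tailTerm : (List ℤ → ℕ) → List ℤ → List ℤ → ℤ
  tailTerm stat σ τ = when (isPosDecreasing τ) (t ^ stat σ * (t - + 1) ^ (length τ ∸ 1))

  splitSum : (List ℤ → ℕ) → List ℤ → ℤ
  splitSum stat π = ∑[ k < length π ] tailTerm stat (take k π) (drop k π)

  splitSum-∷∷ : ∀ stat x y ρ → splitSum stat (x ∷ y ∷ ρ) ≡
    tailTerm stat [] (x ∷ y ∷ ρ) + (tailTerm stat (x ∷ []) (y ∷ ρ) +
      (∑[ j < length ρ ] tailTerm stat (x ∷ y ∷ take j ρ) (drop j ρ)))
  splitSum-∷∷ stat x y ρ =
    trans (∑<-suc (suc (length ρ)) (λ k → tailTerm stat (take k π) (drop k π)))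
          (cong (_+_ (tailTerm stat [] π))
                (∑<-suc (length ρ) (λ k → tailTerm stat (take (suc k) π) (drop (suc k) π))))
    where π = x ∷ y ∷ ρ


  tailTerm-scale : ∀ stat stat′ c σ σ′ τ → stat σ ≡ c ℕ.+ stat′ σ′ →
    tailTerm stat σ τ ≡ t ^ c * tailTerm stat′ σ′ τ
  tailTerm-scale stat stat′ c σ σ′ τ stat≡ = begin
    when p (t ^ stat σ * U)              ≡⟨ cong (λ d → when p (t ^ d * U)) stat≡ ⟩
    when p (t ^ (c ℕ.+ stat′ σ′) * U)    ≡⟨ cong (λ z → when p (z * U)) (ℤ.^-distribˡ-+-* t c (stat′ σ′)) ⟩
    when p (t ^ c * t ^ stat′ σ′ * U)    ≡⟨ cong (when p) (ℤ.*-assoc (t ^ c) (t ^ stat′ σ′) U) ⟩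
    when p (t ^ c * (t ^ stat′ σ′ * U))  ≡⟨ when-*ˡ p (t ^ c) (t ^ stat′ σ′ * U) ⟩
    t ^ c * when p (t ^ stat′ σ′ * U)    ∎
    where
    open ≡-Reasoning
    p = isPosDecreasing τ
    U = (t - + 1) ^ (length τ ∸ 1)

  ∑-tailTerm-scale : ∀ stat stat′ c n (σ σ′ τ : ℕ → List ℤ) →
    (∀ j → stat (σ j) ≡ c ℕ.+ stat′ (σ′ j)) →
    ∑[ j < n ] tailTerm stat (σ j) (τ j) ≡ t ^ c * (∑[ j < n ] tailTerm stat′ (σ′ j) (τ j))
  ∑-tailTerm-scale stat stat′ c n σ σ′ τ stat≡ =
    trans (∑<-cong n (λ {j} _ → tailTerm-scale stat stat′ c (σ j) (σ′ j) (τ j) (stat≡ j)))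
          (∑-*ˡ (upTo n) (t ^ c) (λ j → tailTerm stat′ (σ′ j) (τ j)))

  telescope-step : ∀ {x y} ρ → x ≢ y →
    tailTerm des [] (x ∷ y ∷ ρ) + tailTerm des (x ∷ []) (y ∷ ρ)
      ≡ t ^ bit (y ≤ᵇ x) * tailTerm des (x ∷ []) (y ∷ ρ)
  telescope-step {x} {y} ρ x≢y rewrite ≤ᵇ-flip x≢y with not (x ≤ᵇ y) | isPosDecreasing (y ∷ ρ)
  ... | true  | true  = descent t ((t - + 1) ^ length ρ)
    where
    descent : ∀ t w → + 1 * ((t - + 1) * w) + + 1 * w ≡ t * + 1 * (+ 1 * w)
    descent = solve-∀
  ... | false | true  = ascent ((t - + 1) ^ length ρ)
    where
    ascent : ∀ w → + 0 + + 1 * w ≡ + 1 * (+ 1 * w)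
    ascent = solve-∀
  ... | true  | false = sym (ℤ.*-zeroʳ (t ^ 1))
  ... | false | false = refl

  telescope-des : ∀ π → Linked _≢_ π → splitSum des π ≡ when (lastPos π) (t ^ des π)
  telescope-des []          []  = refl
  telescope-des (x ∷ [])    [-] with isPos x
  ... | true  = refl
  ... | false = refl
  telescope-des (x ∷ y ∷ ρ) (x≢y ∷ distinct) = begin
    splitSum des (x ∷ y ∷ ρ)
      ≡⟨ splitSum-∷∷ des x y ρ ⟩
    T₀ + (T₁ + (∑[ j < length ρ ] tailTerm des (x ∷ y ∷ take j ρ) (drop j ρ)))
      ≡⟨ cong (λ z → T₀ + (T₁ + z)) (∑-tailTerm-scale des des b (length ρ)
           (λ j → x ∷ y ∷ take j ρ) (λ j → y ∷ take j ρ) (λ j → drop j ρ) (λ _ → refl)) ⟩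
    T₀ + (T₁ + t ^ b * R)
      ≡⟨ ℤ.+-assoc T₀ T₁ (t ^ b * R) ⟨
    T₀ + T₁ + t ^ b * R
      ≡⟨ cong (_+ t ^ b * R) (telescope-step ρ x≢y) ⟩
    t ^ b * T₁ + t ^ b * R
      ≡⟨ ℤ.*-distribˡ-+ (t ^ b) T₁ R ⟨
    t ^ b * (T₁ + R)
      ≡⟨ cong (t ^ b *_) (∑<-suc (length ρ) (λ k → tailTerm des (take k (y ∷ ρ)) (drop k (y ∷ ρ)))) ⟨
    t ^ b * splitSum des (y ∷ ρ)
      ≡⟨ cong (t ^ b *_) (telescope-des (y ∷ ρ) distinct) ⟩
    t ^ b * when (lastPos (y ∷ ρ)) (t ^ des (y ∷ ρ))
      ≡⟨ when-*ˡ (lastPos (y ∷ ρ)) (t ^ b) (t ^ des (y ∷ ρ)) ⟨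
    when (lastPos (y ∷ ρ)) (t ^ b * t ^ des (y ∷ ρ))
      ≡⟨ cong (when (lastPos (y ∷ ρ))) (ℤ.^-distribˡ-+-* t b (des (y ∷ ρ))) ⟨
    when (lastPos (x ∷ y ∷ ρ)) (t ^ des (x ∷ y ∷ ρ))
      ∎
    where
    open ≡-Reasoning
    b  = bit (y ≤ᵇ x)
    T₀ = tailTerm des [] (x ∷ y ∷ ρ)
    T₁ = tailTerm des (x ∷ []) (y ∷ ρ)
    R  = ∑[ j < length ρ ] tailTerm des (y ∷ take j ρ) (drop j ρ)

  telescope-desD : ∀ π → Linked _≢_ π → T (even (countNeg π)) →
                   splitSum desD π ≡ when (lastPos π) (t ^ desD π)
  telescope-desD []          distinct _ = telescope-des [] distinct
  telescope-desD (x ∷ [])    distinct _ = telescope-des (x ∷ []) distinct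
  telescope-desD (x ∷ y ∷ ρ) distinct ev = begin
    splitSum desD π
      ≡⟨ splitSum-∷∷ desD x y ρ ⟩
    T₀ + (T₁ + (∑[ j < length ρ ] tailTerm desD (x ∷ y ∷ take j ρ) (drop j ρ)))
      ≡⟨ cong (λ z → T₀ + (T₁ + z)) (∑-tailTerm-scale desD des c (length ρ)
           (λ j → x ∷ y ∷ take j ρ) (λ j → x ∷ y ∷ take j ρ) (λ j → drop j ρ) (λ _ → refl)) ⟩
    T₀ + (T₁ + t ^ c * R)
      ≡⟨ factor (isNeg-reflects (x + y)) ⟩
    t ^ c * (T₀ + (T₁ + R))
      ≡⟨ cong (t ^ c *_) (trans (sym (splitSum-∷∷ des x y ρ)) (telescope-des π distinct)) ⟩
    t ^ c * when (lastPos π) (t ^ des π)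
      ≡⟨ when-*ˡ (lastPos π) (t ^ c) (t ^ des π) ⟨
    when (lastPos π) (t ^ c * t ^ des π)
      ≡⟨ cong (when (lastPos π)) (ℤ.^-distribˡ-+-* t c (des π)) ⟨
    when (lastPos π) (t ^ desD π)
      ∎
    where
    open ≡-Reasoning
    π  = x ∷ y ∷ ρ
    c  = bit (isNeg (x + y))
    T₀ = tailTerm des [] π
    T₁ = tailTerm des (x ∷ []) (y ∷ ρ)
    R  = ∑[ j < length ρ ] tailTerm des (x ∷ y ∷ take j ρ) (drop j ρ)
    factor : ∀ {b} → Reflects (x + y < + 0) b → T₀ + (T₁ + t ^ bit b * R) ≡ t ^ bit b * (T₀ + (T₁ + R))
    factor (ofⁿ _)     = unit T₀ T₁ R
      where
      unit : ∀ a b r → a + (b + + 1 * r) ≡ + 1 * (a + (b + r))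
      unit = solve-∀
    factor (ofʸ x+y<0) = begin
      T₀ + (T₁ + t ^ 1 * R)           ≡⟨ cong₂ (λ a b → a + (b + t ^ 1 * R)) T₀≡0 T₁≡0 ⟩
      + 0 + (+ 0 + t ^ 1 * R)         ≡⟨ only t R ⟩
      t ^ 1 * (+ 0 + (+ 0 + R))       ≡⟨ cong₂ (λ a b → t ^ 1 * (a + (b + R))) T₀≡0 T₁≡0 ⟨
      t ^ 1 * (T₀ + (T₁ + R))         ∎
      where
      T₀≡0 = when-¬ _ (negativeSum-¬isPosDecreasing x y ρ x+y<0)
      T₁≡0 = when-¬ _ (λ pd → negativeSum-¬even x y ρ x+y<0 pd ev)
      only : ∀ t r → + 0 + (+ 0 + t * + 1 * r) ≡ t * + 1 * (+ 0 + (+ 0 + r))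
      only = solve-∀

-- Counting positive decreasing words

data SignedLetter (n : ℕ) : ℤ → Set where
  pos : ∀ {i} → i ℕ.< n → SignedLetter n (+ suc i)
  neg : ∀ {i} → i ℕ.< n → SignedLetter n -[1+ i ]

signedVals-letters : ∀ n → All (SignedLetter n) (signedVals n)
signedVals-letters n = All.++⁺ (All.map⁺ (All.map⁺ (All.map pos below)))
                               (All.map⁺ (All.map⁺ (All.map neg below)))
  where below = All.tabulate ∈-upTo⁻

∑-signedVals : ∀ n f → ∑ (signedVals n) f ≡ (∑[ i < n ] f (+ suc i)) + (∑[ i < n ] f -[1+ i ])
∑-signedVals n f = trans (∑-++ (map +_ (oneTo n)) _ f)
  (cong₂ _+_ (trans (∑-map +_ (oneTo n) f) (∑-map suc (upTo n) (f ∘ +_)))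
             (trans (∑-map (λ i → ℤ.- (+ i)) (oneTo n) f) (∑-map suc (upTo n) (λ i → f (ℤ.- (+ i))))))

hockeyStick : ∀ c m → ∑[ i < c ] + (i C m) ≡ + (c C suc m)
hockeyStick zero    m = refl
hockeyStick (suc c) m = begin
  ∑[ i < suc c ] + (i C m)       ≡⟨ ∑<-snoc c (λ i → + (i C m)) ⟩
  (∑[ i < c ] + (i C m)) + + (c C m) ≡⟨ cong (_+ + (c C m)) (hockeyStick c m) ⟩
  + (c C suc m) + + (c C m)      ≡⟨ ℤ.pos-+ (c C suc m) (c C m) ⟨
  + (c C suc m ℕ.+ c C m)        ≡⟨ cong +_ (trans (ℕ.+-comm (c C suc m) (c C m)) (nCk+nC[k+1]≡[n+1]C[k+1] c m)) ⟩
  + (suc c C suc m)              ∎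
  where open ≡-Reasoning

∑<-truncate : ∀ {c n} → c ℕ.≤ n → ∀ (g : ℕ → ℤ) →
  ∑[ i < n ] when (suc i ℕ.≤ᵇ c) (g i) ≡ ∑[ i < c ] g i
∑<-truncate {zero}  {n}     _           g = ∑-zero (upTo n)
∑<-truncate {suc c} {suc n} (s≤s c≤n) g =
  trans (∑<-suc n (λ i → when (suc i ℕ.≤ᵇ suc c) (g i)))
        (trans (cong (_+_ (g 0)) (∑<-truncate c≤n (g ∘ suc))) (sym (∑<-suc c g)))

-- The bound c on the first entry makes the count inductive: removing a first entry i + 1
-- leaves a positive decreasing word with first entry at most i.
headAtMost : ℕ → List ℤ → Bool
headAtMost c []      = true
headAtMost c (x ∷ _) = x ≤ᵇ + c

not-+suc≤ᵇ : ∀ i z → not (+ suc i ≤ᵇ z) ≡ (z ≤ᵇ + i)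
not-+suc≤ᵇ i (+ k)     = reflects-≡ (λ i≮k → ℕ.s≤s⁻¹ (ℕ.≰⇒> i≮k)) ℕ.≤⇒≯
                                    (¬-reflects (ℕ≤ᵇ-reflects (suc i) k)) (ℕ≤ᵇ-reflects k i)
not-+suc≤ᵇ i -[1+ k ] = refl

isPosDecreasing-+suc : ∀ i c r → (isPosDecreasing (+ suc i ∷ r) ∧ headAtMost c (+ suc i ∷ r))
                                ≡ (suc i ℕ.≤ᵇ c) ∧ (isPosDecreasing r ∧ headAtMost i r)
isPosDecreasing-+suc i c []      = sym (∧-identityʳ _)
isPosDecreasing-+suc i c (z ∷ r) rewrite not-+suc≤ᵇ i z =
  trans (∧-comm _ (suc i ℕ.≤ᵇ c)) (cong (_∧_ (suc i ℕ.≤ᵇ c)) (∧-comm (z ≤ᵇ + i) _))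

isPosDecreasing-negative : ∀ i r → isPosDecreasing (-[1+ i ] ∷ r) ≡ false
isPosDecreasing-negative i []             = refl
isPosDecreasing-negative i (+ k ∷ r)      = refl
isPosDecreasing-negative i (-[1+ k ] ∷ r) rewrite isPosDecreasing-negative k r = ∧-zeroʳ _

count-posDecreasing-headAtMost : ∀ m {c n} → c ℕ.≤ n →
  ∑[ τ ∈ words m (signedVals n) ] when (isPosDecreasing τ ∧ headAtMost c τ) (+ 1) ≡ + (c C m)
count-posDecreasing-headAtMost zero    c≤n = refl
count-posDecreasing-headAtMost (suc m) {c} {n} c≤n = begin
  ∑ (words (suc m) A) F
    ≡⟨ ∑-words-suc m A F ⟩
  ∑[ a ∈ A ] ∑[ r ∈ words m A ] F (a ∷ r)
    ≡⟨ ∑-signedVals n (λ a → ∑[ r ∈ words m A ] F (a ∷ r)) ⟩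
  (∑[ i < n ] ∑[ r ∈ words m A ] F (+ suc i ∷ r)) + (∑[ i < n ] ∑[ r ∈ words m A ] F (-[1+ i ] ∷ r))
    ≡⟨ cong₂ _+_ (∑<-cong n positive) (trans (∑<-cong n negative) (∑-zero (upTo n))) ⟩
  (∑[ i < n ] when (suc i ℕ.≤ᵇ c) (+ (i C m))) + + 0
    ≡⟨ ℤ.+-identityʳ _ ⟩
  ∑[ i < n ] when (suc i ℕ.≤ᵇ c) (+ (i C m))
    ≡⟨ ∑<-truncate c≤n (λ i → + (i C m)) ⟩
  ∑[ i < c ] + (i C m)
    ≡⟨ hockeyStick c m ⟩
  + (c C suc m)
    ∎
  where
  open ≡-Reasoning
  A = signedVals n
  F : List ℤ → ℤ
  F τ = when (isPosDecreasing τ ∧ headAtMost c τ) (+ 1)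
  positive : ∀ {i} → i ℕ.< n → ∑[ r ∈ words m A ] F (+ suc i ∷ r) ≡ when (suc i ℕ.≤ᵇ c) (+ (i C m))
  positive {i} _ = begin
    ∑[ r ∈ words m A ] F (+ suc i ∷ r)
      ≡⟨ ∑-cong (words m A) (λ r → cong (λ b → when b (+ 1)) (isPosDecreasing-+suc i c r)) ⟩
    ∑[ r ∈ words m A ] when ((suc i ℕ.≤ᵇ c) ∧ G r) (+ 1)
      ≡⟨ ∑-cong (words m A) (λ r → when-∧ (suc i ℕ.≤ᵇ c) (G r) (+ 1)) ⟩
    ∑[ r ∈ words m A ] when (suc i ℕ.≤ᵇ c) (when (G r) (+ 1))
      ≡⟨ ∑-when (suc i ℕ.≤ᵇ c) (words m A) (λ r → when (G r) (+ 1)) ⟩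
    when (suc i ℕ.≤ᵇ c) (∑[ r ∈ words m A ] when (G r) (+ 1))
      ≡⟨ when-cong (suc i ℕ.≤ᵇ c) (λ i<c → count-posDecreasing-headAtMost m (i<c⇒i≤n i<c)) ⟩
    when (suc i ℕ.≤ᵇ c) (+ (i C m))
      ∎
    where
    G : List ℤ → Bool
    G r = isPosDecreasing r ∧ headAtMost i r
    i<c⇒i≤n : T (suc i ℕ.≤ᵇ c) → i ℕ.≤ n
    i<c⇒i≤n i<c = ℕ.<⇒≤ (ℕ.<-≤-trans (ℕ.≤ᵇ⇒≤ (suc i) c i<c) c≤n)
  negative : ∀ {i} → i ℕ.< n → ∑[ r ∈ words m A ] F (-[1+ i ] ∷ r) ≡ + 0
  negative {i} _ = trans (∑-cong (words m A) (λ r → cong (λ b → when (b ∧ _) (+ 1)) (isPosDecreasing-negative i r)))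
                         (∑-zero (words m A))

count-posDecreasing : ∀ m n → ∑[ τ ∈ words m (signedVals n) ] when (isPosDecreasing τ) (+ 1) ≡ + (n C m)
count-posDecreasing m n =
  trans (∑-words-cong m (signedVals-letters n) headBounded) (count-posDecreasing-headAtMost m ℕ.≤-refl)
  where
  letter≤n : ∀ {x} → SignedLetter n x → (x ≤ᵇ + n) ≡ true
  letter≤n (pos i<n) = Equivalence.to T-≡ (ℕ.≤⇒≤ᵇ i<n)
  letter≤n (neg _)   = refl
  headBounded : ∀ {τ} → length τ ≡ m → All (SignedLetter n) τ →
    when (isPosDecreasing τ) (+ 1) ≡ when (isPosDecreasing τ ∧ headAtMost n τ) (+ 1)
  headBounded {[]}    _ _       = refl
  headBounded {x ∷ τ} _ (x∈ ∷ _) rewrite letter≤n x∈ = cong (λ b → when b (+ 1)) (sym (∧-identityʳ _))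

-- Pigeonhole for duplicate-free lists

module Pigeonhole {A : Set} (_≟_ : DecidableEquality A) where

  remove : A → List A → List A
  remove y = filter (λ v → ¬? (v ≟ y))

  remove-⊆ : ∀ {y xs ys} → xs ⊆ y ∷ ys → remove y xs ⊆ ys
  remove-⊆ xs⊆y∷ys v∈ with ∈-filter⁻ (λ v → ¬? (v ≟ _)) v∈
  ... | v∈xs , v≢y with xs⊆y∷ys v∈xs
  ...   | here v≡y  = contradiction v≡y v≢y
  ...   | there v∈ys = v∈ys

  length-remove : ∀ {y xs} → Unique xs → length xs ℕ.≤ suc (length (remove y xs))
  length-remove {y} {[]}     []            = z≤n
  length-remove {y} {x ∷ xs} (x∉xs ∷ uxs) with x ≟ y
  ... | yes refl = s≤s (ℕ.≤-reflexive (cong length (sym (filter-all (λ v → ¬? (v ≟ y)) (All.map ≢-sym x∉xs)))))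
  ... | no  _    = s≤s (length-remove uxs)

  unique-⊆⇒length≤ : ∀ {xs ys} → Unique xs → xs ⊆ ys → length xs ℕ.≤ length ys
  unique-⊆⇒length≤ {xs} {[]}     _   xs⊆[]   rewrite Subset.⊆[]⇒≡[] xs⊆[] = z≤n
  unique-⊆⇒length≤ {xs} {y ∷ ys} uxs xs⊆y∷ys =
    ℕ.≤-trans (length-remove uxs) (s≤s (unique-⊆⇒length≤ (Unique.filter⁺ _ uxs) (remove-⊆ xs⊆y∷ys)))

  ⊆-length≤⇒unique : ∀ {xs ys} → Unique xs → xs ⊆ ys → length ys ℕ.≤ length xs → Unique ys
  ⊆-length≤⇒unique {xs} {[]}     _   _       _ = []
  ⊆-length≤⇒unique {xs} {y ∷ ys} uxs xs⊆y∷ys |y∷ys|≤|xs| =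
    All.¬Any⇒All¬ ys y∉ys ∷ ⊆-length≤⇒unique (Unique.filter⁺ _ uxs) (remove-⊆ xs⊆y∷ys)
                          (ℕ.≤-pred (ℕ.≤-trans |y∷ys|≤|xs| (length-remove uxs)))
    where
    y∉ys : ¬ (y ∈ ys)
    y∉ys y∈ys = ℕ.<-irrefl refl (ℕ.≤-trans (s≤s (unique-⊆⇒length≤ uxs xs⊆ys)) |y∷ys|≤|xs|)
      where
      xs⊆ys : xs ⊆ ys
      xs⊆ys v∈xs with xs⊆y∷ys v∈xs
      ... | here refl  = y∈ys
      ... | there v∈ys = v∈ys

open Pigeonhole ℕ._≟_

occursAbs : ℕ → List ℤ → Bool
occursAbs j w = any (λ x → ∣ x ∣ ℕ.≡ᵇ j) w

occursAbs⇒∈ : ∀ {j} w → T (occursAbs j w) → j ∈ map ∣_∣ w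
occursAbs⇒∈ {j} w = Any.map⁺ ∘ Any.map (λ eq → sym (ℕ.≡ᵇ⇒≡ _ j eq)) ∘ any⁻ _ w

∈⇒occursAbs : ∀ {j} w → j ∈ map ∣_∣ w → T (occursAbs j w)
∈⇒occursAbs {j} w = any⁺ _ ∘ Any.map (λ eq → ℕ.≡⇒≡ᵇ _ j (sym eq)) ∘ Any.map⁻

occursAbs-reflects : ∀ j w → Reflects (j ∈ map ∣_∣ w) (occursAbs j w)
occursAbs-reflects j w = fromEquivalence (occursAbs⇒∈ w) (∈⇒occursAbs w)

covers : List ℕ → List ℤ → Bool
covers V w = all (λ j → occursAbs j w) V

covers⇒⊆ : ∀ V w → T (covers V w) → V ⊆ map ∣_∣ w
covers⇒⊆ V w cov j∈V = occursAbs⇒∈ w (All.lookup (All.all⁺ _ V cov) j∈V)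

⊆⇒covers : ∀ V w → V ⊆ map ∣_∣ w → T (covers V w)
⊆⇒covers V w V⊆ = All.all⁻ _ (All.tabulate (∈⇒occursAbs w ∘ V⊆))

covers-reflects : ∀ V w → Reflects (V ⊆ map ∣_∣ w) (covers V w)
covers-reflects V w = fromEquivalence (covers⇒⊆ V w) (⊆⇒covers V w)

length-oneTo : ∀ n → length (oneTo n) ≡ n
length-oneTo n = trans (length-map suc (upTo n)) (length-upTo n)

oneTo-unique : ∀ n → Unique (oneTo n)
oneTo-unique n = Unique.map⁺ ℕ.suc-injective (Unique.upTo⁺ n)

signedPerm⇒unique-abs : ∀ n π → length π ≡ n → T (isSignedPerm n π) → Unique (map ∣_∣ π)
signedPerm⇒unique-abs n π |π|≡n perm =
  ⊆-length≤⇒unique (oneTo-unique n) (covers⇒⊆ (oneTo n) π perm)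
    (ℕ.≤-reflexive (trans (length-map ∣_∣ π) (trans |π|≡n (sym (length-oneTo n)))))

unique-abs⇒distinct-neighbours : ∀ {π} → Unique (map ∣_∣ π) → Linked _≢_ π
unique-abs⇒distinct-neighbours u =
  AllPairs⇒Linked (AllPairs.map (λ ∣x∣≢∣y∣ → ∣x∣≢∣y∣ ∘ cong ∣_∣) (AllPairs.map⁻ u))

unique-++-disjoint : ∀ {A : Set} (xs : List A) {ys v} → Unique (xs ++ ys) → v ∈ xs → v ∉ ys
unique-++-disjoint (x ∷ xs) (x∉ ∷ _) (here refl)  v∈ys = All.lookup x∉ (∈-++⁺ʳ xs v∈ys) refl
unique-++-disjoint (x ∷ xs) (_ ∷ u)  (there v∈xs) = unique-++-disjoint xs u v∈xs

absent : List ℤ → ℕ → Bool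
absent τ j = not (occursAbs j τ)

absent-reflects : ∀ τ j → Reflects (j ∉ map ∣_∣ τ) (absent τ j)
absent-reflects τ j = ¬-reflects (occursAbs-reflects j τ)

complement : ℕ → List ℤ → List ℕ
complement n τ = filter (T? ∘ absent τ) (oneTo n)

isSignedPerm-++ : ∀ n σ τ → length σ ℕ.+ length τ ≡ n →
  isSignedPerm n (σ ++ τ) ≡ all (absent τ ∘ ∣_∣) σ ∧ covers (complement n τ) σ
isSignedPerm-++ n σ τ |στ|≡n =
  reflects-≡ split join (covers-reflects (oneTo n) (σ ++ τ)) (T-reflects _ ×-reflects covers-reflects _ σ)
  where
  abs-++ : map ∣_∣ (σ ++ τ) ≡ map ∣_∣ σ ++ map ∣_∣ τ
  abs-++ = map-++ ∣_∣ σ τ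
  split : oneTo n ⊆ map ∣_∣ (σ ++ τ) → T (all (absent τ ∘ ∣_∣) σ) × complement n τ ⊆ map ∣_∣ σ
  split n⊆ = All.all⁻ _ (All.tabulate avoids) , V⊆
    where
    distinct : Unique (map ∣_∣ σ ++ map ∣_∣ τ)
    distinct = subst Unique abs-++ (signedPerm⇒unique-abs n (σ ++ τ) (trans (length-++ σ) |στ|≡n) (⊆⇒covers _ _ n⊆))
    avoids : ∀ {x} → x ∈ σ → T (absent τ ∣ x ∣)
    avoids x∈σ = reflected⇒T (absent-reflects τ _) (unique-++-disjoint (map ∣_∣ σ) distinct (∈-map⁺ ∣_∣ x∈σ))
    V⊆ : complement n τ ⊆ map ∣_∣ σ
    V⊆ {j} j∈V with ∈-filter⁻ (T? ∘ absent τ) {xs = oneTo n} j∈V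
    ... | j∈n , j-absent with ∈-++⁻ (map ∣_∣ σ) (subst (_ ∈_) abs-++ (n⊆ j∈n))
    ...   | inj₁ j∈σ = j∈σ
    ...   | inj₂ j∈τ = ⊥-elim (T⇒reflected (absent-reflects τ j) j-absent j∈τ)
  join : T (all (absent τ ∘ ∣_∣) σ) × complement n τ ⊆ map ∣_∣ σ → oneTo n ⊆ map ∣_∣ (σ ++ τ)
  join (_ , V⊆) {j} j∈n = subst (j ∈_) (sym abs-++) (side (occursAbs-reflects j τ))
    where
    side : ∀ {b} → Reflects (j ∈ map ∣_∣ τ) b → j ∈ map ∣_∣ σ ++ map ∣_∣ τ
    side (ofʸ j∈τ) = ∈-++⁺ʳ (map ∣_∣ σ) j∈τ
    side (ofⁿ j∉τ) = ∈-++⁺ˡ (V⊆ (∈-filter⁺ (T? ∘ absent τ) j∈n (reflected⇒T (absent-reflects τ j) j∉τ)))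

length-filter-not : ∀ {A : Set} (p : A → Bool) xs →
  length (filter (T? ∘ (not ∘ p)) xs) ℕ.+ length (filter (T? ∘ p) xs) ≡ length xs
length-filter-not p []       = refl
length-filter-not p (x ∷ xs) with p x
... | true  = trans (ℕ.+-suc _ _) (cong suc (length-filter-not p xs))
... | false = cong suc (length-filter-not p xs)

complement-length : ∀ n τ → Unique (map ∣_∣ τ) → map ∣_∣ τ ⊆ oneTo n →
  length (complement n τ) ℕ.+ length τ ≡ n
complement-length n τ τ-unique τ⊆n = begin
  length (complement n τ) ℕ.+ length τ        ≡⟨ cong (length (complement n τ) ℕ.+_) |present|≡|τ| ⟨
  length (complement n τ) ℕ.+ length present  ≡⟨ length-filter-not (λ j → occursAbs j τ) (oneTo n) ⟩
  length (oneTo n)                            ≡⟨ length-oneTo n ⟩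
  n                                           ∎
  where
  open ≡-Reasoning
  present = filter (T? ∘ (λ j → occursAbs j τ)) (oneTo n)
  present⊆τ : present ⊆ map ∣_∣ τ
  present⊆τ j∈ = occursAbs⇒∈ τ (proj₂ (∈-filter⁻ (T? ∘ (λ j → occursAbs j τ)) {xs = oneTo n} j∈))
  τ⊆present : map ∣_∣ τ ⊆ present
  τ⊆present j∈ = ∈-filter⁺ (T? ∘ (λ j → occursAbs j τ)) (τ⊆n j∈) (∈⇒occursAbs τ j∈)
  |present|≡|τ| : length present ≡ length τ
  |present|≡|τ| = ℕ.≤-antisym
    (ℕ.≤-trans (unique-⊆⇒length≤ (Unique.filter⁺ _ (oneTo-unique n)) present⊆τ)
               (ℕ.≤-reflexive (length-map ∣_∣ τ)))
    (ℕ.≤-trans (ℕ.≤-reflexive (sym (length-map ∣_∣ τ))) (unique-⊆⇒length≤ τ-unique τ⊆present))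

letters-abs⊆oneTo : ∀ {n w} → All (SignedLetter n) w → map ∣_∣ w ⊆ oneTo n
letters-abs⊆oneTo letters j∈ with ∈-map⁻ ∣_∣ j∈
... | x , x∈w , refl = abs∈ (All.lookup letters x∈w)
  where
  abs∈ : ∀ {n x} → SignedLetter n x → ∣ x ∣ ∈ oneTo n
  abs∈ (pos i<n) = ∈-map⁺ suc (∈-upTo⁺ i<n)
  abs∈ (neg i<n) = ∈-map⁺ suc (∈-upTo⁺ i<n)

∣∣-mono-< : ∀ {x y} → + 0 < y → y < x → ∣ y ∣ ℕ.< ∣ x ∣
∣∣-mono-< (ℤ.+<+ _) (ℤ.+<+ y<x) = y<x

isPosDecreasing-below : ∀ x r → T (isPosDecreasing (x ∷ r)) → All (λ y → ∣ y ∣ ℕ.< ∣ x ∣) r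
isPosDecreasing-below x []      _  = []
isPosDecreasing-below x (y ∷ r) pd with x ≤ᵇ y | ≤ᵇ-reflects x y
... | false | ofⁿ x≰y =
  ∣y∣<∣x∣ ∷ All.map (λ ∣z∣<∣y∣ → ℕ.<-trans ∣z∣<∣y∣ ∣y∣<∣x∣) (isPosDecreasing-below y r pd)
  where ∣y∣<∣x∣ = ∣∣-mono-< (isPosDecreasing-head y r pd) (ℤ.≰⇒> x≰y)

isPosDecreasing⇒unique-abs : ∀ τ → T (isPosDecreasing τ) → Unique (map ∣_∣ τ)
isPosDecreasing⇒unique-abs []      _  = []
isPosDecreasing⇒unique-abs (x ∷ r) pd =
  All.map⁺ (All.map (λ ∣y∣<∣x∣ → ℕ.>⇒≢ ∣y∣<∣x∣) (isPosDecreasing-below x r pd))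
  ∷ isPosDecreasing⇒unique-abs r (isPosDecreasing-tail x r pd)

-- Standardization

countBelow : ℕ → List ℕ → ℕ
countBelow v W = length (filter (ℕ._<? v) W)

countBelow-mono : ∀ {a b} → a ℕ.≤ b → ∀ W → countBelow a W ℕ.≤ countBelow b W
countBelow-mono a≤b []      = z≤n
countBelow-mono {a} {b} a≤b (z ∷ W) with z ℕ.<ᵇ a | ℕ<ᵇ-reflects z a | z ℕ.<ᵇ b | ℕ<ᵇ-reflects z b
... | true  | _         | true  | _         = s≤s (countBelow-mono a≤b W)
... | false | _         | true  | _         = ℕ.m≤n⇒m≤1+n (countBelow-mono a≤b W)
... | false | _         | false | _         = countBelow-mono a≤b W
... | true  | ofʸ z<a   | false | ofⁿ z≮b   = contradiction (ℕ.<-≤-trans z<a a≤b) z≮b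

countBelow-strict : ∀ {a b} → a ℕ.< b → ∀ {W} → a ∈ W → countBelow a W ℕ.< countBelow b W
countBelow-strict {a} {b} a<b {z ∷ W} (here refl) with z ℕ.<ᵇ z | ℕ<ᵇ-reflects z z | z ℕ.<ᵇ b | ℕ<ᵇ-reflects z b
... | false | _         | true  | _         = s≤s (countBelow-mono (ℕ.<⇒≤ a<b) W)
... | true  | ofʸ z<z   | _     | _         = contradiction z<z (ℕ.<-irrefl refl)
... | false | _         | false | ofⁿ z≮b   = contradiction a<b z≮b
countBelow-strict {a} {b} a<b {z ∷ W} (there a∈W) with z ℕ.<ᵇ a | ℕ<ᵇ-reflects z a | z ℕ.<ᵇ b | ℕ<ᵇ-reflects z b
... | true  | _         | true  | _         = s≤s (countBelow-strict a<b a∈W)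
... | false | _         | true  | _         = ℕ.m<n⇒m<1+n (countBelow-strict a<b a∈W)
... | false | _         | false | _         = countBelow-strict a<b a∈W
... | true  | ofʸ z<a   | false | ofⁿ z≮b   = contradiction (ℕ.<-trans z<a a<b) z≮b

rank : List ℕ → ℕ → ℕ
rank V v = suc (countBelow v V)

countBelow-least : ∀ {v W} → All (v ℕ.≤_) W → countBelow v W ≡ 0
countBelow-least []                    = refl
countBelow-least {v} {z ∷ W} (v≤z ∷ vW) with z ℕ.<ᵇ v | ℕ<ᵇ-reflects z v
... | false | _       = countBelow-least vW
... | true  | ofʸ z<v = contradiction v≤z (ℕ.<⇒≱ z<v)

countBelow-∷-< : ∀ {v w} W → v ℕ.< w → countBelow w (v ∷ W) ≡ suc (countBelow w W)
countBelow-∷-< {v} {w} W v<w with v ℕ.<ᵇ w | ℕ<ᵇ-reflects v w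
... | true  | _       = refl
... | false | ofⁿ v≮w = contradiction v<w v≮w

oneTo-suc : ∀ k → oneTo (suc k) ≡ 1 ∷ map suc (oneTo k)
oneTo-suc k = cong (λ xs → 1 ∷ map suc xs) (sym (map-upTo suc k))

map-rank : ∀ {V} → AllPairs ℕ._<_ V → map (rank V) V ≡ oneTo (length V)
map-rank {[]}    []             = refl
map-rank {v ∷ V} (v<V ∷ incr) = begin
  rank (v ∷ V) v ∷ map (rank (v ∷ V)) V  ≡⟨ cong₂ _∷_ (cong suc (countBelow-least (ℕ.≤-refl ∷ All.map ℕ.<⇒≤ v<V)))
                                           (map-cong-local (All.map (cong suc ∘ countBelow-∷-< V) v<V)) ⟩
  1 ∷ map (suc ∘ rank V) V               ≡⟨ cong (1 ∷_) (map-∘ V) ⟩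
  1 ∷ map suc (map (rank V) V)           ≡⟨ cong (λ xs → 1 ∷ map suc xs) (map-rank incr) ⟩
  1 ∷ map suc (oneTo (length V))         ≡⟨ oneTo-suc (length V) ⟨
  oneTo (suc (length V))                 ∎
  where open ≡-Reasoning

signed : List ℕ → List ℤ
signed V = map (λ i → + i) V ++ map (λ i → ℤ.- (+ i)) V

module Standardization (V : List ℕ) where

  countBelow-≤-reflect : ∀ {a b} → b ∈ V → countBelow a V ℕ.≤ countBelow b V → a ℕ.≤ b
  countBelow-≤-reflect b∈V ca≤cb = ℕ.≮⇒≥ (λ b<a → ℕ.<⇒≱ (countBelow-strict b<a b∈V) ca≤cb)

  countBelow-<-reflect : ∀ {a b} → a ∈ V → countBelow a V ℕ.< countBelow b V → a ℕ.< b
  countBelow-<-reflect a∈V ca<cb = ℕ.≰⇒> (λ b≤a → ℕ.<⇒≱ ca<cb (countBelow-mono b≤a V))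

  rank-injective : ∀ {a b} → a ∈ V → b ∈ V → rank V a ≡ rank V b → a ≡ b
  rank-injective a∈V b∈V ra≡rb = ℕ.≤-antisym
    (countBelow-≤-reflect b∈V (ℕ.≤-reflexive (ℕ.suc-injective ra≡rb)))
    (countBelow-≤-reflect a∈V (ℕ.≤-reflexive (ℕ.suc-injective (sym ra≡rb))))

  data Letter : ℤ → Set where
    pos : ∀ {v} → v ∈ V → Letter (+ v)
    neg : ∀ {v} → suc v ∈ V → Letter -[1+ v ]

  -- ψ x = sign x · rank V ∣x∣, written out for the encoding -[1+ v ] = -(v + 1).
  ψ : ℤ → ℤ
  ψ (+ v)     = + rank V v
  ψ -[1+ v ] = -[1+ countBelow (suc v) V ]

  ∣ψ∣ : ∀ {x} → Letter x → ∣ ψ x ∣ ≡ rank V ∣ x ∣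
  ∣ψ∣ (pos _) = refl
  ∣ψ∣ (neg _) = refl

  ψ-mono-≤ : ∀ {x y} → Letter x → Letter y → x ≤ y → ψ x ≤ ψ y
  ψ-mono-≤ (pos _) (pos _) (+≤+ a≤b) = +≤+ (s≤s (countBelow-mono a≤b V))
  ψ-mono-≤ (neg _) (pos _) _          = -≤+
  ψ-mono-≤ (neg _) (neg _) (-≤- b≤a) = -≤- (countBelow-mono (s≤s b≤a) V)

  ψ-≤-reflect : ∀ {x y} → Letter x → Letter y → ψ x ≤ ψ y → x ≤ y
  ψ-≤-reflect (pos _) (pos b∈V) (+≤+ (s≤s ca≤cb)) = +≤+ (countBelow-≤-reflect b∈V ca≤cb)
  ψ-≤-reflect (neg _) (pos _)   _                   = -≤+
  ψ-≤-reflect (neg a∈V) (neg _) (-≤- cb≤ca)       = -≤- (ℕ.s≤s⁻¹ (countBelow-≤-reflect a∈V cb≤ca))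

  ψ-≤ᵇ : ∀ {x y} → Letter x → Letter y → (ψ x ≤ᵇ ψ y) ≡ (x ≤ᵇ y)
  ψ-≤ᵇ {x} {y} lx ly =
    reflects-≡ (ψ-≤-reflect lx ly) (ψ-mono-≤ lx ly) (≤ᵇ-reflects (ψ x) (ψ y)) (≤ᵇ-reflects x y)

  rank-<ᵇ : ∀ {a b} → a ∈ V → (rank V a ℕ.<ᵇ rank V b) ≡ (a ℕ.<ᵇ b)
  rank-<ᵇ {a} {b} a∈V = reflects-≡ (λ ra<rb → countBelow-<-reflect a∈V (ℕ.s≤s⁻¹ ra<rb))
                                   (λ a<b → s≤s (countBelow-strict a<b a∈V))
                                   (ℕ<ᵇ-reflects (rank V a) (rank V b)) (ℕ<ᵇ-reflects a b)

  ψ-isNeg-+ : ∀ {x y} → Letter x → Letter y → isNeg (ψ x + ψ y) ≡ isNeg (x + y)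
  ψ-isNeg-+ (pos _) (pos _) = refl
  ψ-isNeg-+ (neg _) (neg _) = refl
  ψ-isNeg-+ {+ a} { -[1+ b ]} (pos a∈V) (neg _) =
    trans (isNeg-⊖ (rank V a) (rank V (suc b))) (trans (rank-<ᵇ a∈V) (sym (isNeg-⊖ a (suc b))))
  ψ-isNeg-+ { -[1+ a ]} {+ b} (neg _) (pos b∈V) =
    trans (isNeg-⊖ (rank V b) (rank V (suc a))) (trans (rank-<ᵇ b∈V) (sym (isNeg-⊖ b (suc a))))

  des-ψ : ∀ {σ} → All Letter σ → des (map ψ σ) ≡ des σ
  des-ψ []                     = refl
  des-ψ (_ ∷ [])               = refl
  des-ψ (lx ∷ ly ∷ lσ)         = cong₂ ℕ._+_ (cong bit (ψ-≤ᵇ ly lx)) (des-ψ (ly ∷ lσ))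

  desD-ψ : ∀ {σ} → All Letter σ → desD (map ψ σ) ≡ desD σ
  desD-ψ []                    = refl
  desD-ψ (_ ∷ [])              = refl
  desD-ψ ls@(lx ∷ ly ∷ _)      = cong₂ ℕ._+_ (cong bit (ψ-isNeg-+ lx ly)) (des-ψ ls)

  countNeg-ψ : ∀ {σ} → All Letter σ → countNeg (map ψ σ) ≡ countNeg σ
  countNeg-ψ []            = refl
  countNeg-ψ (pos _ ∷ lσ) = countNeg-ψ lσ
  countNeg-ψ (neg _ ∷ lσ) = cong suc (countNeg-ψ lσ)

  letter-abs∈V : ∀ {x} → Letter x → ∣ x ∣ ∈ V
  letter-abs∈V (pos v∈V) = v∈V
  letter-abs∈V (neg v∈V) = v∈V

  abs-ψ : ∀ {σ} → All Letter σ → map ∣_∣ (map ψ σ) ≡ map (rank V) (map ∣_∣ σ)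
  abs-ψ []          = refl
  abs-ψ (lx ∷ lσ) = cong₂ _∷_ (∣ψ∣ lx) (abs-ψ lσ)

  covers-ψ : ∀ {σ} → All Letter σ → covers (map (rank V) V) (map ψ σ) ≡ covers V σ
  covers-ψ {σ} lσ = reflects-≡ reflect (subst (map (rank V) V ⊆_) (sym (abs-ψ lσ)) ∘ Subset.map⁺ (rank V))
    (covers-reflects (map (rank V) V) (map ψ σ)) (covers-reflects V σ)
    where
    reflect : map (rank V) V ⊆ map ∣_∣ (map ψ σ) → V ⊆ map ∣_∣ σ
    reflect rV⊆ {j} j∈V with ∈-map⁻ (rank V) (subst (rank V j ∈_) (abs-ψ lσ) (rV⊆ (∈-map⁺ (rank V) j∈V)))
    ... | a , a∈σ , rj≡ra with ∈-map⁻ ∣_∣ a∈σ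
    ...   | x , x∈σ , refl rewrite rank-injective j∈V (letter-abs∈V (All.lookup lσ x∈σ)) rj≡ra = a∈σ

  module _ (positive : All (0 ℕ.<_) V) where

    signed-letters : All Letter (signed V)
    signed-letters = All.++⁺ (All.map⁺ (All.tabulate pos)) (All.map⁺ (All.tabulate negative))
      where
      negative : ∀ {v} → v ∈ V → Letter (ℤ.- (+ v))
      negative {suc v} v∈V = neg v∈V
      negative {zero}  0∈V = contradiction (All.lookup positive 0∈V) (ℕ.<-irrefl refl)

    map-ψ-signed : AllPairs ℕ._<_ V → map ψ (signed V) ≡ signedVals (length V)
    map-ψ-signed increasing = begin
      map ψ (signed V)
        ≡⟨ map-++ ψ (map (λ i → + i) V) _ ⟩
      map ψ (map (λ i → + i) V) ++ map ψ (map (λ i → ℤ.- (+ i)) V)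
        ≡⟨ cong₂ _++_ (trans (sym (map-∘ V)) (map-∘ V))
                      (trans (sym (map-∘ V)) (trans (map-cong-local (All.tabulate ψ-negative)) (map-∘ V))) ⟩
      signed (map (rank V) V)
        ≡⟨ cong signed (map-rank increasing) ⟩
      signedVals (length V)
        ∎
      where
      open ≡-Reasoning
      ψ-negative : ∀ {v} → v ∈ V → ψ (ℤ.- (+ v)) ≡ ℤ.- (+ rank V v)
      ψ-negative {suc v} _   = refl
      ψ-negative {zero}  0∈V = contradiction (All.lookup positive 0∈V) (ℕ.<-irrefl refl)

    ∑-standardize : AllPairs ℕ._<_ V → ∀ t →
      ∑[ σ ∈ words (length V) (signed V) ] when (covers V σ ∧ even (countNeg σ)) (t ^ desD σ)
        ≡ Dpoly (length V) t
    ∑-standardize increasing t = sym (begin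
      Dpoly k t
        ≡⟨ ∑-filter (isDn k) (words k (signedVals k)) (λ σ → t ^ desD σ) ⟩
      ∑[ σ ∈ words k (signedVals k) ] when (isDn k σ) (t ^ desD σ)
        ≡⟨ cong (λ A → ∑[ σ ∈ words k A ] when (isDn k σ) (t ^ desD σ)) (map-ψ-signed increasing) ⟨
      ∑[ σ ∈ words k (map ψ (signed V)) ] when (isDn k σ) (t ^ desD σ)
        ≡⟨ ∑-words-map k ψ (signed V) (λ σ → when (isDn k σ) (t ^ desD σ)) ⟩
      ∑[ σ ∈ words k (signed V) ] when (isDn k (map ψ σ)) (t ^ desD (map ψ σ))
        ≡⟨ ∑-words-cong k signed-letters transport ⟩
      ∑[ σ ∈ words k (signed V) ] when (covers V σ ∧ even (countNeg σ)) (t ^ desD σ)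
        ∎)
      where
      open ≡-Reasoning
      k = length V
      transport : ∀ {σ} → length σ ≡ k → All Letter σ →
        when (isDn k (map ψ σ)) (t ^ desD (map ψ σ)) ≡ when (covers V σ ∧ even (countNeg σ)) (t ^ desD σ)
      transport {σ} _ lσ = cong₂ (λ b d → when b (t ^ d))
        (cong₂ _∧_ (trans (cong (λ U → covers U (map ψ σ)) (sym (map-rank increasing))) (covers-ψ lσ))
                   (cong even (countNeg-ψ lσ)))
        (desD-ψ lσ)

-- Summing over D_n by prefixes and suffixes

countNeg-++ : ∀ σ τ → countNeg (σ ++ τ) ≡ countNeg σ ℕ.+ countNeg τ
countNeg-++ []      τ = refl
countNeg-++ (x ∷ σ) τ with isNeg x
... | true  = cong suc (countNeg-++ σ τ)
... | false = countNeg-++ σ τ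

filter-abs-map : ∀ (p : ℕ → Bool) (f : ℕ → ℤ) → (∀ i → ∣ f i ∣ ≡ i) → ∀ L →
  filter (T? ∘ (p ∘ ∣_∣)) (map f L) ≡ map f (filter (T? ∘ p) L)
filter-abs-map p f ∣f∣ []      = refl
filter-abs-map p f ∣f∣ (i ∷ L) rewrite ∣f∣ i with p i
... | true  = cong (f i ∷_) (filter-abs-map p f ∣f∣ L)
... | false = filter-abs-map p f ∣f∣ L

filter-abs-signed : ∀ (p : ℕ → Bool) L → filter (T? ∘ (p ∘ ∣_∣)) (signed L) ≡ signed (filter (T? ∘ p) L)
filter-abs-signed p L = trans (filter-++ (T? ∘ (p ∘ ∣_∣)) (map (λ i → + i) L) _)
  (cong₂ _++_ (filter-abs-map p (λ i → + i) (λ _ → refl) L)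
              (filter-abs-map p (λ i → ℤ.- (+ i)) (ℤ.∣-i∣≡∣i∣ ∘ +_) L))

oneTo-increasing : ∀ n → AllPairs ℕ._<_ (oneTo n)
oneTo-increasing n = AllPairs.map⁺ (AllPairs.applyUpTo⁺₁ id n (λ i<j _ → s≤s i<j))

oneTo-positive : ∀ n → All (0 ℕ.<_) (oneTo n)
oneTo-positive n = All.map⁺ (All.tabulate (λ _ → s≤s z≤n))

isDn-++ : ∀ n σ τ → length σ ℕ.+ length τ ≡ n → T (isPosDecreasing τ) →
  isDn n (σ ++ τ) ≡ all (absent τ ∘ ∣_∣) σ ∧ (covers (complement n τ) σ ∧ even (countNeg σ))
isDn-++ n σ τ |στ|≡n pd = begin
  isSignedPerm n (σ ++ τ) ∧ even (countNeg (σ ++ τ))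
    ≡⟨ cong₂ _∧_ (isSignedPerm-++ n σ τ |στ|≡n) (cong even (countNeg-++ σ τ)) ⟩
  (avoids ∧ covered) ∧ even (countNeg σ ℕ.+ countNeg τ)
    ≡⟨ cong (λ c → (avoids ∧ covered) ∧ even (countNeg σ ℕ.+ c)) (isPosDecreasing-countNeg τ pd) ⟩
  (avoids ∧ covered) ∧ even (countNeg σ ℕ.+ 0)
    ≡⟨ cong (λ c → (avoids ∧ covered) ∧ even c) (ℕ.+-identityʳ (countNeg σ)) ⟩
  (avoids ∧ covered) ∧ even (countNeg σ)
    ≡⟨ ∧-assoc avoids covered (even (countNeg σ)) ⟩
  avoids ∧ (covered ∧ even (countNeg σ))
    ∎
  where
  open ≡-Reasoning
  avoids  = all (absent τ ∘ ∣_∣) σ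
  covered = covers (complement n τ) σ

∑-prefixes-desD : ∀ t n k τ → T (isPosDecreasing τ) → All (SignedLetter n) τ → k ℕ.+ length τ ≡ n →
  ∑[ σ ∈ words k (signedVals n) ] when (isDn n (σ ++ τ)) (t ^ desD σ) ≡ Dpoly k t
∑-prefixes-desD t n k τ pd letters k+|τ|≡n = begin
  ∑[ σ ∈ words k (signedVals n) ] when (isDn n (σ ++ τ)) (t ^ desD σ)
    ≡⟨ ∑-words-cong k (signedVals-letters n) split ⟩
  ∑[ σ ∈ words k (signedVals n) ] when (all (absent τ ∘ ∣_∣) σ) (G σ)
    ≡⟨ ∑-words-restrict k (absent τ ∘ ∣_∣) (signedVals n) G ⟩
  ∑ (words k (filter (T? ∘ (absent τ ∘ ∣_∣)) (signedVals n))) G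
    ≡⟨ cong (λ A → ∑ (words k A) G) (filter-abs-signed (absent τ) (oneTo n)) ⟩
  ∑ (words k (signed V)) G
    ≡⟨ cong (λ k → ∑ (words k (signed V)) G) |V|≡k ⟨
  ∑ (words (length V) (signed V)) G
    ≡⟨ Standardization.∑-standardize V positive increasing t ⟩
  Dpoly (length V) t
    ≡⟨ cong (λ k → Dpoly k t) |V|≡k ⟩
  Dpoly k t
    ∎
  where
  open ≡-Reasoning
  V = complement n τ
  G : List ℤ → ℤ
  G σ = when (covers V σ ∧ even (countNeg σ)) (t ^ desD σ)
  increasing : AllPairs ℕ._<_ V
  increasing = AllPairs.filter⁺ _ (oneTo-increasing n)
  positive : All (0 ℕ.<_) V
  positive = All.filter⁺ _ (oneTo-positive n)
  |V|≡k : length V ≡ k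
  |V|≡k = ℕ.+-cancelʳ-≡ (length τ) (length V) k
    (trans (complement-length n τ (isPosDecreasing⇒unique-abs τ pd) (letters-abs⊆oneTo letters)) (sym k+|τ|≡n))
  split : ∀ {σ} → length σ ≡ k → All (SignedLetter n) σ →
    when (isDn n (σ ++ τ)) (t ^ desD σ) ≡ when (all (absent τ ∘ ∣_∣) σ) (G σ)
  split {σ} |σ|≡k _ =
    trans (cong (λ b → when b (t ^ desD σ)) (isDn-++ n σ τ (trans (cong (ℕ._+ length τ) |σ|≡k) k+|τ|≡n) pd))
          (when-∧ (all (absent τ ∘ ∣_∣) σ) _ (t ^ desD σ))

take-++ : ∀ {A : Set} (σ τ : List A) → take (length σ) (σ ++ τ) ≡ σ
take-++ []      τ = refl
take-++ (x ∷ σ) τ = cong (x ∷_) (take-++ σ τ)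

drop-++ : ∀ {A : Set} (σ τ : List A) → drop (length σ) (σ ++ τ) ≡ τ
drop-++ []      τ = refl
drop-++ (x ∷ σ) τ = drop-++ σ τ

module _ (t : ℤ) where

  ∑-prefixes-tailTerm : ∀ n k m τ → All (SignedLetter n) τ → length τ ≡ m → k ℕ.+ m ≡ n →
    ∑[ σ ∈ words k (signedVals n) ] when (isDn n (σ ++ τ)) (tailTerm t desD σ τ)
      ≡ when (isPosDecreasing τ) (Dpoly k t * (t - + 1) ^ (m ∸ 1))
  ∑-prefixes-tailTerm n k m τ letters refl k+m≡n = ≡when (isPosDecreasing τ) suffix non-suffix
    where
    A = signedVals n
    U = (t - + 1) ^ (length τ ∸ 1)
    non-suffix : ¬ T (isPosDecreasing τ) →
                 ∑[ σ ∈ words k A ] when (isDn n (σ ++ τ)) (tailTerm t desD σ τ) ≡ + 0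
    non-suffix ¬pd = trans (∑-cong (words k A) (λ σ → trans (cong (when (isDn n (σ ++ τ))) (when-¬ _ ¬pd))
                                                            (when-zero (isDn n (σ ++ τ)))))
                           (∑-zero (words k A))
    suffix : T (isPosDecreasing τ) →
             ∑[ σ ∈ words k A ] when (isDn n (σ ++ τ)) (tailTerm t desD σ τ) ≡ Dpoly k t * U
    suffix pd = begin
      ∑[ σ ∈ words k A ] when (isDn n (σ ++ τ)) (when (isPosDecreasing τ) (t ^ desD σ * U))
        ≡⟨ ∑-cong (words k A) (λ σ → cong (when (isDn n (σ ++ τ))) (when-T (t ^ desD σ * U) pd)) ⟩
      ∑[ σ ∈ words k A ] when (isDn n (σ ++ τ)) (t ^ desD σ * U)
        ≡⟨ ∑-cong (words k A) (λ σ → when-*ʳ (isDn n (σ ++ τ)) (t ^ desD σ) U) ⟩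
      ∑[ σ ∈ words k A ] when (isDn n (σ ++ τ)) (t ^ desD σ) * U
        ≡⟨ ∑-*ʳ (words k A) (λ σ → when (isDn n (σ ++ τ)) (t ^ desD σ)) U ⟩
      (∑[ σ ∈ words k A ] when (isDn n (σ ++ τ)) (t ^ desD σ)) * U
        ≡⟨ cong (_* U) (∑-prefixes-desD t n k τ pd letters k+m≡n) ⟩
      Dpoly k t * U
        ∎
      where open ≡-Reasoning

  ∑-Dn-tailTerm : ∀ {n k} → k ℕ.< n →
    ∑[ π ∈ words n (signedVals n) ] when (isDn n π) (tailTerm t desD (take k π) (drop k π))
      ≡ + (n C k) * Dpoly k t * (t - + 1) ^ (n ∸ k ∸ 1)
  ∑-Dn-tailTerm {n} {k} k<n = begin
    ∑ (words n A) F
      ≡⟨ cong (λ N → ∑ (words N A) F) k+m≡n ⟨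
    ∑ (words (k ℕ.+ m) A) F
      ≡⟨ ∑-words-++ k m A F ⟩
    ∑[ σ ∈ words k A ] ∑[ τ ∈ words m A ] F (σ ++ τ)
      ≡⟨ ∑-words-cong k (signedVals-letters n) (λ {σ} |σ|≡k _ → ∑-cong (words m A) (λ τ → split σ τ |σ|≡k)) ⟩
    ∑[ σ ∈ words k A ] ∑[ τ ∈ words m A ] when (isDn n (σ ++ τ)) (tailTerm t desD σ τ)
      ≡⟨ ∑-comm (words k A) (words m A) (λ σ τ → when (isDn n (σ ++ τ)) (tailTerm t desD σ τ)) ⟩
    ∑[ τ ∈ words m A ] ∑[ σ ∈ words k A ] when (isDn n (σ ++ τ)) (tailTerm t desD σ τ)
      ≡⟨ ∑-words-cong m (signedVals-letters n)
           (λ {τ} |τ|≡m letters → ∑-prefixes-tailTerm n k m τ letters |τ|≡m k+m≡n) ⟩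
    ∑[ τ ∈ words m A ] when (isPosDecreasing τ) (Dpoly k t * U)
      ≡⟨ ∑-when-const (words m A) isPosDecreasing (Dpoly k t * U) ⟩
    Dpoly k t * U * (∑[ τ ∈ words m A ] when (isPosDecreasing τ) (+ 1))
      ≡⟨ cong (λ c → Dpoly k t * U * c) (count-posDecreasing m n) ⟩
    Dpoly k t * U * + (n C m)
      ≡⟨ cong (λ c → Dpoly k t * U * + c) (nCk≡nC[n∸k] (ℕ.<⇒≤ k<n)) ⟨
    Dpoly k t * U * + (n C k)
      ≡⟨ reorder (Dpoly k t) U (+ (n C k)) ⟩
    + (n C k) * Dpoly k t * U
      ∎
    where
    open ≡-Reasoning
    A = signedVals n
    m = n ∸ k
    U = (t - + 1) ^ (m ∸ 1)
    k+m≡n : k ℕ.+ m ≡ n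
    k+m≡n = ℕ.m+[n∸m]≡n (ℕ.<⇒≤ k<n)
    F : List ℤ → ℤ
    F π = when (isDn n π) (tailTerm t desD (take k π) (drop k π))
    split : ∀ σ τ → length σ ≡ k → F (σ ++ τ) ≡ when (isDn n (σ ++ τ)) (tailTerm t desD σ τ)
    split σ τ refl =
      cong₂ (λ σ′ τ′ → when (isDn n (σ ++ τ)) (tailTerm t desD σ′ τ′)) (take-++ σ τ) (drop-++ σ τ)
    reorder : ∀ d u c → d * u * c ≡ c * d * u
    reorder = solve-∀

  isDn-telescope : ∀ n π → length π ≡ n →
    when (isDn n π) (when (lastPos π) (t ^ desD π))
      ≡ ∑[ k < n ] when (isDn n π) (tailTerm t desD (take k π) (drop k π))
  isDn-telescope n π |π|≡n = trans (when-cong (isDn n π) telescope) (sym (∑-when (isDn n π) (upTo n) _))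
    where
    telescope : T (isDn n π) → when (lastPos π) (t ^ desD π) ≡ ∑[ k < n ] tailTerm t desD (take k π) (drop k π)
    telescope Dnπ = let perm , ev = Equivalence.to T-∧ Dnπ in
      trans (sym (telescope-desD t π (unique-abs⇒distinct-neighbours (signedPerm⇒unique-abs n π |π|≡n perm)) ev))
            (cong (λ N → ∑[ k < N ] tailTerm t desD (take k π) (drop k π)) |π|≡n)

lemma3p2 : (n : ℕ) → n ≥ 1 → (t : ℤ) →
    desDPoly (Dn⁺ n) t
      ≡ sumBelow n (λ k → (+ (n C k)) * Dpoly k t * ((t - + 1) ^ (n ∸ k ∸ 1)))
lemma3p2 n _ t = begin
  desDPoly (Dn⁺ n) t
    ≡⟨ ∑-filter lastPos (Dn n) (λ π → t ^ desD π) ⟩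
  ∑[ π ∈ Dn n ] when (lastPos π) (t ^ desD π)
    ≡⟨ ∑-filter (isDn n) (words n A) (λ π → when (lastPos π) (t ^ desD π)) ⟩
  ∑[ π ∈ words n A ] when (isDn n π) (when (lastPos π) (t ^ desD π))
    ≡⟨ ∑-words-cong n (signedVals-letters n) (λ {π} |π|≡n _ → isDn-telescope t n π |π|≡n) ⟩
  ∑[ π ∈ words n A ] (∑[ k < n ] term k π)
    ≡⟨ ∑-comm (words n A) (upTo n) (λ π k → term k π) ⟩
  ∑[ k < n ] (∑[ π ∈ words n A ] term k π)
    ≡⟨ ∑<-cong n (∑-Dn-tailTerm t) ⟩
  sumBelow n (λ k → (+ (n C k)) * Dpoly k t * ((t - + 1) ^ (n ∸ k ∸ 1)))
    ∎
  where
  open ≡-Reasoning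
  A = signedVals n
  term : ℕ → List ℤ → ℤ
  term k π = when (isDn n π) (tailTerm t desD (take k π) (drop k π))
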